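{- Let $A$ be a $\delta$-algebra and let $x\in A$ satisfy $x\le f_{1/2^n}(1)$ for all $n\in\mathbb{N}$. Then $x\in\mathrm{Rad}\,A$.
   Context: An MV-algebra is a structure $(A,\oplus,\neg,0)$ such that $(A,\oplus,0)$ is a commutative monoid, $\neg\neg x=x$, $x\oplus\neg 0=\neg 0$, and $\neg(\neg x\oplus y)\oplus y=\neg(\neg y\oplus x)\oplus x$. Write $1:=\neg 0$, $x\odot y:=\neg(\neg x\oplus\neg y)$, $x\ominus y:=x\odot\neg y$, $d(x,y):=(x\ominus y)\oplus(y\ominus x)$; $x\le y$ iff $x\ominus y=0$ defines a lattice order with $x\vee y=\neg(\neg x\oplus y)\oplus y$. An ideal is a subset containing $0$, downward closed and closed under $\oplus$; $\mathrm{Rad}\,A$ is the intersection of all maximal (proper) ideals of the underlying MV-algebra. A $\delta$-algebra is a structure $(A,\delta,\oplus,\neg,0)$ where $(A,\oplus,\neg,0)$ is an MV-algebra and $\delta$ is an operation of countably infinite arity such that, writing $\vec x=(x_1,x_2,\ldots)$, $\vec 0=(0,0,\ldots)$ and $f_{1/2}(x):=\delta(x,\vec 0)$: (A1) $d(\delta(\vec x),\delta(x_1,\vec 0))=\delta(0,x_2,x_3,\ldots)$; (A2) $f_{1/2}(\delta(\vec x))=\delta(f_{1/2}(x_1),f_{1/2}(x_2),\ldots)$; (A3) $\delta(x,x,\ldots)=x$; (A4) $\delta(0,\vec x)=f_{1/2}(\delta(\vec x))$; (A5) $\delta(x_1\oplus y_1,x_2\oplus y_2,\ldots)\ge\delta(x_1,x_2,\ldots)$;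 (A6) $f_{1/2}(x\ominus y)=f_{1/2}(x)\ominus f_{1/2}(y)$. $f_{1/2^n}$ is the $n$-fold iterate of $f_{1/2}$. -}

module Defs where

open import Level using (Level; suc; _⊔_)
open import Data.Nat using (ℕ; zero) renaming (suc to sucℕ)
open import Data.Product using (_×_)
open import Data.Sum using (_⊎_)
open import Relation.Nullary using (¬_)
open import Relation.Binary.PropositionalEquality using (_≡_)

record MVAlgebra (a : Level) : Set (suc a) where
  infixl 6 _⊕_
  field
    Carrier : Set a
    _⊕_     : Carrier → Carrier → Carrier
    ¬'      : Carrier → Carrier
    𝟘       : Carrier
    ⊕-assoc    : ∀ x y z → (x ⊕ y) ⊕ z ≡ x ⊕ (y ⊕ z)
    ⊕-comm     : ∀ x y → x ⊕ y ≡ y ⊕ x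
    ⊕-identityʳ : ∀ x → x ⊕ 𝟘 ≡ x
    ¬¬-involutive : ∀ x → ¬' (¬' x) ≡ x
    ⊕-absorb   : ∀ x → x ⊕ ¬' 𝟘 ≡ ¬' 𝟘
    luk        : ∀ x y → ¬' (¬' x ⊕ y) ⊕ y ≡ ¬' (¬' y ⊕ x) ⊕ x

  𝟙 : Carrier
  𝟙 = ¬' 𝟘

  _⊙_ : Carrier → Carrier → Carrier
  x ⊙ y = ¬' (¬' x ⊕ ¬' y)

  _⊖_ : Carrier → Carrier → Carrier
  x ⊖ y = x ⊙ ¬' y

  dist : Carrier → Carrier → Carrier
  dist x y = (x ⊖ y) ⊕ (y ⊖ x)

  _≤_ : Carrier → Carrier → Set a
  x ≤ y = x ⊖ y ≡ 𝟘

  record IsIdeal (I : Carrier → Set a) : Set a where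
    field
      zero∈  : I 𝟘
      down   : ∀ {x y} → x ≤ y → I y → I x
      ⊕-closed : ∀ {x y} → I x → I y → I (x ⊕ y)

  record IsMaximalIdeal (I : Carrier → Set a) : Set (suc a) where
    field
      isIdeal : IsIdeal I
      proper  : ¬ (∀ x → I x)
      maximal : ∀ (J : Carrier → Set a) → IsIdeal J → (∀ x → I x → J x) →
                (∀ x → J x → I x) ⊎ (∀ x → J x)

  _∈Rad : Carrier → Set (suc a)
  x ∈Rad = ∀ (I : Carrier → Set a) → IsMaximalIdeal I → I x

_∷ₛ_ : ∀ {a} {A : Set a} → A → (ℕ → A) → (ℕ → A)
(x ∷ₛ xs) zero     = x
(x ∷ₛ xs) (sucℕ n) = xs n

-- δ-algebra; a sequence (x₁, x₂, …) is a function ℕ → Carrier (index 0 ↦ x₁).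
record DeltaAlgebra (a : Level) : Set (suc a) where
  field
    mv : MVAlgebra a
  open MVAlgebra mv public
  field
    δ : (ℕ → Carrier) → Carrier
    δ-cong : ∀ (xs ys : ℕ → Carrier) → (∀ i → xs i ≡ ys i) → δ xs ≡ δ ys

  0⃗ : ℕ → Carrier
  0⃗ _ = 𝟘

  tailₛ : (ℕ → Carrier) → (ℕ → Carrier)
  tailₛ xs n = xs (sucℕ n)

  f½ : Carrier → Carrier
  f½ x = δ (x ∷ₛ 0⃗)

  field
    A1 : ∀ xs → dist (δ xs) (δ (xs zero ∷ₛ 0⃗)) ≡ δ (𝟘 ∷ₛ tailₛ xs)
    A2 : ∀ xs → f½ (δ xs) ≡ δ (λ i → f½ (xs i))
    A3 : ∀ x → δ (λ _ → x) ≡ x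
    A4 : ∀ xs → δ (𝟘 ∷ₛ xs) ≡ f½ (δ xs)
    A5 : ∀ (xs ys : ℕ → Carrier) → δ xs ≤ δ (λ i → xs i ⊕ ys i)
    A6 : ∀ x y → f½ (x ⊖ y) ≡ f½ x ⊖ f½ y

  f½^ : ℕ → Carrier → Carrier
  f½^ zero     x = x
  f½^ (sucℕ n) x = f½ (f½^ n x)

-- Fix a maximal ideal I and suppose x ∉ I. The ideal generated by I and x
-- is then everything, so i ⊕ 2ᵏx = 1 for some i ∈ I and some k. As
-- 2ᵏx ≤ 2ᵏ·f_{1/2^(k+1)}(1) = f_{1/2}(1), also i ⊕ f_{1/2}(1) = 1, i.e.
-- ¬f_{1/2}(1) ≤ i. By (A1), (A3), (A4) the element f_{1/2}(1) is its own
-- negation, so f_{1/2}(1) ∈ I, and then 1 = f_{1/2}(1) ⊕ f_{1/2}(1) ∈ I,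
-- contradicting properness.
module Submission where

open import Defs
open import Level using (Level)
open import Algebra.Bundles using (CommutativeSemigroup)
open import Data.Nat using (ℕ; zero; suc; _+_; _⊔_; _≤′_; ≤′-refl; ≤′-step)
open import Data.Nat.Properties using (≤⇒≤′; m≤m⊔n; m≤n⊔m)
open import Data.Product using (∃₂; _×_; _,_)
open import Data.Sum as Sum using (_⊎_)
open import Data.Empty using (⊥-elim)
open import Function using (id)
open import Relation.Binary.PropositionalEquality
open ≡-Reasoning

module MVProperties {a : Level} (M : MVAlgebra a) where
  open MVAlgebra M

  ⊕-commutativeSemigroup : CommutativeSemigroup a a
  ⊕-commutativeSemigroup = record
    { _≈_ = _≡_
    ; _∙_ = _⊕_
    ; isCommutativeSemigroup = record
      { isSemigroup = record
        { isMagma = record { isEquivalence = isEquivalence ; ∙-cong = cong₂ _⊕_ }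
        ; assoc = ⊕-assoc
        }
      ; comm = ⊕-comm
      }
    }

  open import Algebra.Properties.CommutativeSemigroup ⊕-commutativeSemigroup
    using (interchange)

  x⊖y≡¬[¬x⊕y] : ∀ x y → x ⊖ y ≡ ¬' (¬' x ⊕ y)
  x⊖y≡¬[¬x⊕y] x y = cong (λ t → ¬' (¬' x ⊕ t)) (¬¬-involutive y)

  ⊕-identityˡ : ∀ x → 𝟘 ⊕ x ≡ x
  ⊕-identityˡ x = trans (⊕-comm 𝟘 x) (⊕-identityʳ x)

  ⊕-zeroˡ : ∀ x → 𝟙 ⊕ x ≡ 𝟙
  ⊕-zeroˡ x = trans (⊕-comm 𝟙 x) (⊕-absorb x)

  ¬𝟙≡𝟘 : ¬' 𝟙 ≡ 𝟘
  ¬𝟙≡𝟘 = ¬¬-involutive 𝟘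

  ¬x⊕x≡𝟙 : ∀ x → ¬' x ⊕ x ≡ 𝟙
  ¬x⊕x≡𝟙 x = begin
    ¬' x ⊕ x           ≡⟨ cong (λ t → ¬' t ⊕ x) (sym (⊕-identityˡ x)) ⟩
    ¬' (𝟘 ⊕ x) ⊕ x     ≡⟨ cong (λ t → ¬' (t ⊕ x) ⊕ x) (sym ¬𝟙≡𝟘) ⟩
    ¬' (¬' 𝟙 ⊕ x) ⊕ x  ≡⟨ sym (luk x 𝟙) ⟩
    ¬' (¬' x ⊕ 𝟙) ⊕ 𝟙  ≡⟨ ⊕-absorb _ ⟩
    𝟙                  ∎

  𝟙⊖x≡¬x : ∀ x → 𝟙 ⊖ x ≡ ¬' x
  𝟙⊖x≡¬x x = begin
    𝟙 ⊖ x             ≡⟨ x⊖y≡¬[¬x⊕y] 𝟙 x ⟩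
    ¬' (¬' 𝟙 ⊕ x)     ≡⟨ cong (λ t → ¬' (t ⊕ x)) ¬𝟙≡𝟘 ⟩
    ¬' (𝟘 ⊕ x)        ≡⟨ cong ¬' (⊕-identityˡ x) ⟩
    ¬' x              ∎

  x≤x⊕y : ∀ x y → x ≤ (x ⊕ y)
  x≤x⊕y x y = begin
    x ⊖ (x ⊕ y)          ≡⟨ x⊖y≡¬[¬x⊕y] x (x ⊕ y) ⟩
    ¬' (¬' x ⊕ (x ⊕ y))  ≡⟨ cong ¬' (sym (⊕-assoc _ _ _)) ⟩
    ¬' ((¬' x ⊕ x) ⊕ y)  ≡⟨ cong (λ t → ¬' (t ⊕ y)) (¬x⊕x≡𝟙 x) ⟩
    ¬' (𝟙 ⊕ y)           ≡⟨ cong ¬' (⊕-zeroˡ y) ⟩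
    ¬' 𝟙                 ≡⟨ ¬𝟙≡𝟘 ⟩
    𝟘                    ∎

  y⊖x⊕x≡y : ∀ {x y} → x ≤ y → (y ⊖ x) ⊕ x ≡ y
  y⊖x⊕x≡y {x} {y} x≤y = begin
    (y ⊖ x) ⊕ x        ≡⟨ cong (_⊕ x) (x⊖y≡¬[¬x⊕y] y x) ⟩
    ¬' (¬' y ⊕ x) ⊕ x  ≡⟨ luk y x ⟩
    ¬' (¬' x ⊕ y) ⊕ y  ≡⟨ cong (_⊕ y) (trans (sym (x⊖y≡¬[¬x⊕y] x y)) x≤y) ⟩
    𝟘 ⊕ y              ≡⟨ ⊕-identityˡ y ⟩
    y                  ∎

  ≤-refl : ∀ x → x ≤ x
  ≤-refl x = subst (x ≤_) (⊕-identityʳ x) (x≤x⊕y x 𝟘)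

  ≤-reflexive : ∀ {x y} → x ≡ y → x ≤ y
  ≤-reflexive {x} refl = ≤-refl x

  ≤-trans : ∀ {x y z} → x ≤ y → y ≤ z → x ≤ z
  ≤-trans {x} {y} {z} x≤y y≤z = subst (x ≤_) x⊕[y⊖x⊕z⊖y]≡z (x≤x⊕y x _)
    where
    x⊕[y⊖x⊕z⊖y]≡z : x ⊕ ((y ⊖ x) ⊕ (z ⊖ y)) ≡ z
    x⊕[y⊖x⊕z⊖y]≡z = begin
      x ⊕ ((y ⊖ x) ⊕ (z ⊖ y))  ≡⟨ sym (⊕-assoc _ _ _) ⟩
      (x ⊕ (y ⊖ x)) ⊕ (z ⊖ y)  ≡⟨ cong (_⊕ (z ⊖ y)) (trans (⊕-comm _ _) (y⊖x⊕x≡y x≤y)) ⟩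
      y ⊕ (z ⊖ y)              ≡⟨ trans (⊕-comm _ _) (y⊖x⊕x≡y y≤z) ⟩
      z                        ∎

  𝟘≤x : ∀ x → 𝟘 ≤ x
  𝟘≤x x = subst (𝟘 ≤_) (⊕-identityˡ x) (x≤x⊕y 𝟘 x)

  x≤𝟙 : ∀ x → x ≤ 𝟙
  x≤𝟙 x = trans (x⊖y≡¬[¬x⊕y] x 𝟙) (trans (cong ¬' (⊕-absorb (¬' x))) ¬𝟙≡𝟘)

  𝟙≤x⇒x≡𝟙 : ∀ {x} → 𝟙 ≤ x → x ≡ 𝟙
  𝟙≤x⇒x≡𝟙 {x} 𝟙≤x = begin
    x          ≡⟨ sym (¬¬-involutive x) ⟩
    ¬' (¬' x)  ≡⟨ cong ¬' (sym (𝟙⊖x≡¬x x)) ⟩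
    ¬' (𝟙 ⊖ x) ≡⟨ cong ¬' 𝟙≤x ⟩
    𝟙          ∎

  x⊕y≡𝟙⇒¬x≤y : ∀ {x y} → x ⊕ y ≡ 𝟙 → ¬' x ≤ y
  x⊕y≡𝟙⇒¬x≤y {x} {y} x⊕y≡𝟙 = begin
    ¬' (¬' (¬' x) ⊕ ¬' (¬' y))  ≡⟨ cong₂ (λ s t → ¬' (s ⊕ t)) (¬¬-involutive x) (¬¬-involutive y) ⟩
    ¬' (x ⊕ y)                  ≡⟨ cong ¬' x⊕y≡𝟙 ⟩
    ¬' 𝟙                        ≡⟨ ¬𝟙≡𝟘 ⟩
    𝟘                           ∎

  ⊕-monoˡ-≤ : ∀ {x y} z → x ≤ y → (x ⊕ z) ≤ (y ⊕ z)
  ⊕-monoˡ-≤ {x} {y} z x≤y = subst ((x ⊕ z) ≤_) x⊕z⊕[y⊖x]≡y⊕z (x≤x⊕y (x ⊕ z) (y ⊖ x))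
    where
    x⊕z⊕[y⊖x]≡y⊕z : (x ⊕ z) ⊕ (y ⊖ x) ≡ y ⊕ z
    x⊕z⊕[y⊖x]≡y⊕z = begin
      (x ⊕ z) ⊕ (y ⊖ x)  ≡⟨ ⊕-assoc x z _ ⟩
      x ⊕ (z ⊕ (y ⊖ x))  ≡⟨ cong (x ⊕_) (⊕-comm z _) ⟩
      x ⊕ ((y ⊖ x) ⊕ z)  ≡⟨ sym (⊕-assoc x _ z) ⟩
      (x ⊕ (y ⊖ x)) ⊕ z  ≡⟨ cong (_⊕ z) (trans (⊕-comm _ _) (y⊖x⊕x≡y x≤y)) ⟩
      y ⊕ z              ∎

  ⊕-mono-≤ : ∀ {x y u v} → x ≤ y → u ≤ v → (x ⊕ u) ≤ (y ⊕ v)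
  ⊕-mono-≤ {x} {y} {u} {v} x≤y u≤v = ≤-trans (⊕-monoˡ-≤ u x≤y)
    (subst₂ _≤_ (⊕-comm u y) (⊕-comm v y) (⊕-monoˡ-≤ y u≤v))

  ⊕-monoʳ-≤ : ∀ x {u v} → u ≤ v → (x ⊕ u) ≤ (x ⊕ v)
  ⊕-monoʳ-≤ x = ⊕-mono-≤ (≤-refl x)

  infixr 25 2^_·_
  2^_·_ : ℕ → Carrier → Carrier
  2^ zero  · y = y
  2^ suc k · y = 2^ k · (y ⊕ y)

  2^·-double : ∀ k y → 2^ k · y ⊕ 2^ k · y ≡ 2^ suc k · y
  2^·-double zero    y = refl
  2^·-double (suc k) y = 2^·-double k (y ⊕ y)

  2^·-monoʳ-≤ : ∀ k {y z} → y ≤ z → 2^ k · y ≤ 2^ k · z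
  2^·-monoʳ-≤ zero    y≤z = y≤z
  2^·-monoʳ-≤ (suc k) y≤z = 2^·-monoʳ-≤ k (⊕-mono-≤ y≤z y≤z)

  2^·-monoˡ-≤ : ∀ {k m} y → k ≤′ m → 2^ k · y ≤ 2^ m · y
  2^·-monoˡ-≤ y ≤′-refl = ≤-refl _
  2^·-monoˡ-≤ {m = suc m} y (≤′-step k≤′m) =
    ≤-trans (2^·-monoˡ-≤ y k≤′m) (2^·-monoʳ-≤ m (x≤x⊕y y y))

  -- The ideal generated by I ∪ {x}; multiples 2ᵏx already bound every n·x.
  adjoin : (Carrier → Set a) → Carrier → Carrier → Set a
  adjoin I x y = ∃₂ λ k i → I i × y ≤ (i ⊕ 2^ k · x)

  module _ {I : Carrier → Set a} (isIdeal : IsIdeal I) (x : Carrier) where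
    open IsIdeal isIdeal

    adjoin-isIdeal : IsIdeal (adjoin I x)
    adjoin-isIdeal = record
      { zero∈    = 0 , 𝟘 , zero∈ , 𝟘≤x _
      ; down     = λ { y≤z (k , i , i∈I , z≤) → k , i , i∈I , ≤-trans y≤z z≤ }
      ; ⊕-closed = adjoin-⊕-closed
      }
      where
      adjoin-⊕-closed : ∀ {y z} → adjoin I x y → adjoin I x z → adjoin I x (y ⊕ z)
      adjoin-⊕-closed (k , i , i∈I , y≤) (l , j , j∈I , z≤) =
        suc (k ⊔ l) , i ⊕ j , ⊕-closed i∈I j∈I ,
        ≤-trans (⊕-mono-≤ y≤ z≤) (≤-trans
          (⊕-mono-≤ (⊕-monoʳ-≤ i (2^·-monoˡ-≤ x (≤⇒≤′ (m≤m⊔n k l))))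
                    (⊕-monoʳ-≤ j (2^·-monoˡ-≤ x (≤⇒≤′ (m≤n⊔m k l)))))
          (≤-reflexive (trans (interchange i _ j _) (cong ((i ⊕ j) ⊕_) (2^·-double (k ⊔ l) x)))))

    ⊆adjoin : ∀ {y} → I y → adjoin I x y
    ⊆adjoin {y} y∈I = 0 , y , y∈I , x≤x⊕y y x

    ∈adjoin : adjoin I x x
    ∈adjoin = 0 , 𝟘 , zero∈ , subst (x ≤_) (sym (⊕-identityˡ x)) (≤-refl x)

  maximal⇒∈⊎⊕2^·≡𝟙 : ∀ {I} → IsMaximalIdeal I → ∀ x →
                      I x ⊎ ∃₂ λ k i → I i × i ⊕ 2^ k · x ≡ 𝟙
  maximal⇒∈⊎⊕2^·≡𝟙 {I} I-max x =
    Sum.map (λ adjoin⊆I → adjoin⊆I x (∈adjoin isIdeal x)) (λ adjoin≡⊤ → from-𝟙∈adjoin (adjoin≡⊤ 𝟙))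
      (maximal (adjoin I x) (adjoin-isIdeal isIdeal x) (λ _ → ⊆adjoin isIdeal x))
    where
    open IsMaximalIdeal I-max
    from-𝟙∈adjoin : adjoin I x 𝟙 → ∃₂ λ k i → I i × i ⊕ 2^ k · x ≡ 𝟙
    from-𝟙∈adjoin (k , i , i∈I , 𝟙≤) = k , i , i∈I , 𝟙≤x⇒x≡𝟙 𝟙≤

module DeltaProperties {a : Level} (A : DeltaAlgebra a) where
  open DeltaAlgebra A
  open MVProperties mv

  infix 25 ½^_
  ½^_ : ℕ → Carrier
  ½^ n = f½^ n 𝟙

  f½-𝟘 : f½ 𝟘 ≡ 𝟘
  f½-𝟘 = trans (δ-cong _ _ (λ { zero → refl ; (suc _) → refl })) (A3 𝟘)

  f½-mono-≤ : ∀ {x y} → x ≤ y → f½ x ≤ f½ y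
  f½-mono-≤ {x} {y} x≤y = trans (sym (A6 x y)) (trans (cong f½ x≤y) f½-𝟘)

  ¬½≡½ : ¬' (½^ 1) ≡ ½^ 1
  ¬½≡½ = begin
    ¬' (½^ 1)                          ≡⟨ sym (⊕-identityʳ _) ⟩
    ¬' (½^ 1) ⊕ 𝟘                      ≡⟨ cong₂ _⊕_ (sym (𝟙⊖x≡¬x _)) (sym (x≤𝟙 _)) ⟩
    dist 𝟙 (½^ 1)                      ≡⟨ cong (λ t → dist t (½^ 1)) (sym (A3 𝟙)) ⟩
    dist (δ (λ _ → 𝟙)) (δ (𝟙 ∷ₛ 0⃗))   ≡⟨ A1 (λ _ → 𝟙) ⟩
    δ (𝟘 ∷ₛ (λ _ → 𝟙))                 ≡⟨ A4 (λ _ → 𝟙) ⟩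
    f½ (δ (λ _ → 𝟙))                   ≡⟨ cong f½ (A3 𝟙) ⟩
    ½^ 1                               ∎

  ½^-suc-≤ : ∀ n → ½^ suc n ≤ ½^ n
  ½^-suc-≤ zero    = x≤𝟙 _
  ½^-suc-≤ (suc n) = f½-mono-≤ (½^-suc-≤ n)

  ½^n⊖½^[1+n]≡½^[1+n] : ∀ n → ½^ n ⊖ ½^ suc n ≡ ½^ suc n
  ½^n⊖½^[1+n]≡½^[1+n] zero    = trans (𝟙⊖x≡¬x _) ¬½≡½
  ½^n⊖½^[1+n]≡½^[1+n] (suc n) = trans (sym (A6 _ _)) (cong f½ (½^n⊖½^[1+n]≡½^[1+n] n))

  ½^[1+n]⊕½^[1+n]≡½^n : ∀ n → ½^ suc n ⊕ ½^ suc n ≡ ½^ n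
  ½^[1+n]⊕½^[1+n]≡½^n n =
    trans (cong (_⊕ ½^ suc n) (sym (½^n⊖½^[1+n]≡½^[1+n] n))) (y⊖x⊕x≡y (½^-suc-≤ n))

  2^k·½^[k+n]≡½^n : ∀ k n → 2^ k · ½^ (k + n) ≡ ½^ n
  2^k·½^[k+n]≡½^n zero    n = refl
  2^k·½^[k+n]≡½^n (suc k) n = begin
    2^ k · (½^ suc (k + n) ⊕ ½^ suc (k + n))  ≡⟨ cong (2^ k ·_) (½^[1+n]⊕½^[1+n]≡½^n (k + n)) ⟩
    2^ k · ½^ (k + n)                         ≡⟨ 2^k·½^[k+n]≡½^n k n ⟩
    ½^ n                                      ∎

lemma5p1 : ∀ {a : Level} (A : DeltaAlgebra a) (x : DeltaAlgebra.Carrier A) →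
             (∀ (n : ℕ) → DeltaAlgebra._≤_ A x (DeltaAlgebra.f½^ A n (DeltaAlgebra.𝟙 A))) →
             DeltaAlgebra._∈Rad A x
lemma5p1 A x x≤½^ I I-max = Sum.[ id , ⊕2^·≡𝟙⇒∈ ]′ (maximal⇒∈⊎⊕2^·≡𝟙 I-max x)
  where
  open DeltaAlgebra A
  open MVProperties mv
  open DeltaProperties A
  open IsMaximalIdeal I-max
  open IsIdeal isIdeal

  ⊕2^·≡𝟙⇒∈ : (∃₂ λ k i → I i × i ⊕ 2^ k · x ≡ 𝟙) → I x
  ⊕2^·≡𝟙⇒∈ (k , i , i∈I , i⊕2^k·x≡𝟙) = ⊥-elim (proper λ z → down (x≤𝟙 z) 𝟙∈I)
    where
    2^k·x≤½ : 2^ k · x ≤ ½^ 1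
    2^k·x≤½ = subst (2^ k · x ≤_) (2^k·½^[k+n]≡½^n k 1) (2^·-monoʳ-≤ k (x≤½^ (k + 1)))

    𝟙≤i⊕½ : 𝟙 ≤ (i ⊕ ½^ 1)
    𝟙≤i⊕½ = subst (_≤ (i ⊕ ½^ 1)) i⊕2^k·x≡𝟙 (⊕-monoʳ-≤ i 2^k·x≤½)

    ½∈I : I (½^ 1)
    ½∈I = down (subst (_≤ i) ¬½≡½ (x⊕y≡𝟙⇒¬x≤y (trans (⊕-comm _ i) (𝟙≤x⇒x≡𝟙 𝟙≤i⊕½)))) i∈I

    𝟙∈I : I 𝟙
    𝟙∈I = subst I (½^[1+n]⊕½^[1+n]≡½^n 0) (⊕-closed ½∈I ½∈I)
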